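{- In the $F_3$ Black Hole Zeckendorf game, if $a\equiv 1\pmod 3$ and $b\equiv 0\pmod 3$, or if $a\equiv 0\pmod 3$ and $b\equiv 1\pmod 3$, then $(a,b)$ is a $P$ position.
   Context: The $F_3$ Black Hole Zeckendorf game: a position is a pair $(a,b)$ of nonnegative integers, the numbers of pieces in the columns of weight $F_1=1$ and $F_2=2$. Two players alternate moves; the available moves are: (merge) if $a\ge 2$, go to $(a-2,b+1)$; (add) if $a\ge1,b\ge1$, go to $(a-1,b-1)$; (split) if $b\ge 2$, go to $(a+1,b-2)$ (pieces landing in column $F_3$, the "black hole", are removed). The player making the last move wins. A position is a $P$ position if the player to move from it loses under optimal play, and an $N$ position if the player to move can force a win; positions with no move are $P$ positions. -}

module Defs where

open import Data.Nat using (ℕ; suc)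
open import Data.Product using (_×_; _,_)

-- A position (a , b): a pieces in column F₁ = 1, b pieces in column F₂ = 2.
Position : Set
Position = ℕ × ℕ

data Move : Position → Position → Set where
  merge : ∀ {a b} → Move (suc (suc a) , b) (a , suc b)
  add   : ∀ {a b} → Move (suc a , suc b) (a , b)
  split : ∀ {a b} → Move (a , suc (suc b)) (suc a , b)

-- The game terminates (a+2b never increases and a+b strictly decreases when
-- a+2b is unchanged), so this inductive characterization is the standard one.
mutual
  data IsP : Position → Set where
    isP : ∀ {p} → (∀ {q} → Move p q → IsN q) → IsP p

  data IsN : Position → Set where
    isN : ∀ {p q} → Move p q → IsP q → IsN p

{-# OPTIONS --safe #-}
module Submission where

-- Modulo 3, every move adds the same nonzero amount to both columns: 1 for merge
-- and split (−2 ≡ 1, +1, −2 ≡ 1), 2 for add. From residues (1, 0) or (0, 1) any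
-- move therefore reaches residues from which a move of the complementary amount
-- is available and restores the original residues. As a + b strictly decreases,
-- the player who always answers this way makes the last move.

open import Defs
open import Data.Nat using (ℕ; zero; suc; _+_; _<_; s≤s; NonZero)
open import Data.Nat.DivMod using (_%_; %-distribˡ-+)
open import Data.Nat.Induction using (<-wellFounded)
open import Data.Nat.Properties using (+-suc; +-monoʳ-≤; n≤1+n; ≤-reflexive; <-trans)
open import Data.Product using (_×_; _,_; ∃-syntax; map₂)
open import Data.Sum using (_⊎_; inj₁; inj₂)
open import Induction.WellFounded using (Acc; acc)
open import Relation.Binary.PropositionalEquality using (_≡_; refl; sym; trans; cong)

size : Position → ℕ
size (a , b) = a + b

size-decreasing : ∀ {p q} → Move p q → size q < size p
size-decreasing {suc (suc a) , b} merge = s≤s (≤-reflexive (+-suc a b))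
size-decreasing {suc a , suc b}   add   = s≤s (+-monoʳ-≤ a (n≤1+n b))
size-decreasing {a , suc (suc b)} split =
  ≤-reflexive (sym (trans (+-suc a (suc b)) (cong suc (+-suc a b))))

answerable⇒IsP : {S : Position → Set} →
                 (∀ {p q} → S p → Move p q → ∃[ q′ ] Move q q′ × S q′) →
                 ∀ {p} → S p → IsP p
answerable⇒IsP {S} answer = go (<-wellFounded _)
  where
  go : ∀ {p} → Acc _<_ (size p) → S p → IsP p
  go (acc rec) sp = isP λ m →
    let (q′ , m′ , sq′) = answer sp m
    in isN m′ (go (rec (<-trans (size-decreasing m′) (size-decreasing m))) sq′)

+-%-≡ : ∀ k n {r} d .{{_ : NonZero d}} → n % d ≡ r → (k + n) % d ≡ (k % d + r) % d
+-%-≡ k n d refl = %-distribˡ-+ k n d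

HasResidues : ℕ → ℕ → Position → Set
HasResidues r s (a , b) = a % 3 ≡ r × b % 3 ≡ s

shift : ∀ {p q} → Move p q → ℕ
shift merge = 1
shift add   = 2
shift split = 1

-- Removing j pieces from a column is treated as adding 3 − j, since (3 + n) % 3 reduces to n % 3.
residues-after : ∀ {p q r s} (m : Move p q) → HasResidues r s p →
                 HasResidues ((shift m + r) % 3) ((shift m + s) % 3) q
residues-after {suc (suc a) , b} merge (ha , hb) = +-%-≡ 1 (2 + a) 3 ha , +-%-≡ 1 b 3 hb
residues-after {suc a , suc b}   add   (ha , hb) = +-%-≡ 2 (1 + a) 3 ha , +-%-≡ 2 (1 + b) 3 hb
residues-after {a , suc (suc b)} split (ha , hb) = +-%-≡ 1 a 3 ha , +-%-≡ 1 (2 + b) 3 hb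

MovesToResidues : ℕ → ℕ → Position → Set
MovesToResidues r s q = ∃[ q′ ] Move q q′ × HasResidues r s q′

add-available : ∀ {r s q} → HasResidues (suc r) (suc s) q →
                MovesToResidues ((2 + suc r) % 3) ((2 + suc s) % 3) q
add-available {q = zero , _}      (() , _)
add-available {q = suc _ , zero}  (_ , ())
add-available {q = suc a , suc b} h = (a , b) , add , residues-after {suc a , suc b} add h

merge-available : ∀ {s q} → HasResidues 2 s q → MovesToResidues 0 ((1 + s) % 3) q
merge-available {q = zero , _}        (() , _)
merge-available {q = suc zero , _}    (() , _)
merge-available {q = suc (suc a) , b} h = (a , suc b) , merge , residues-after {suc (suc a) , b} merge h

split-available : ∀ {r q} → HasResidues r 2 q → MovesToResidues ((1 + r) % 3) 0 q
split-available {q = _ , zero}        (_ , ())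
split-available {q = _ , suc zero}    (_ , ())
split-available {q = a , suc (suc b)} h = (suc a , b) , split , residues-after {a , suc (suc b)} split h

Residues10or01 : Position → Set
Residues10or01 p = HasResidues 1 0 p ⊎ HasResidues 0 1 p

counter-move : ∀ {p q} → Residues10or01 p → Move p q → ∃[ q′ ] Move q q′ × Residues10or01 q′
counter-move (inj₁ h) m@merge = map₂ (map₂ inj₁) (add-available   (residues-after m h))
counter-move (inj₁ h) m@add   = map₂ (map₂ inj₁) (split-available (residues-after m h))
counter-move (inj₁ h) m@split = map₂ (map₂ inj₁) (add-available   (residues-after m h))
counter-move (inj₂ h) m@merge = map₂ (map₂ inj₂) (add-available   (residues-after m h))
counter-move (inj₂ h) m@add   = map₂ (map₂ inj₂) (merge-available (residues-after m h))
counter-move (inj₂ h) m@split = map₂ (map₂ inj₂) (add-available   (residues-after m h))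

theorem4p5 : (a b : ℕ) → ((a % 3 ≡ 1 × b % 3 ≡ 0) ⊎ (a % 3 ≡ 0 × b % 3 ≡ 1)) → IsP (a , b)
theorem4p5 a b = answerable⇒IsP counter-move
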